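{- Define polynomials $F_n^{(v)}(z)$ in the two variables $v,z$ by $F_1^{(v)}(z)=1$ and \[ F^{(v)}_{n+1}(z)=(z+1)(z-v+1)F^{(v)}_{n}(z+1)-z(z-v)F^{(v)}_{n}(z)\quad(n\geq1), \] and let $g_n(v):=F_n^{(v)}(v)$, a polynomial in $v$. Then for every $n\geq2$, the polynomial $g_n(v)$ is divisible by $v+1$. -}

module Defs where

open import Data.Nat using (ℕ; zero; suc)
open import Data.Integer using (ℤ; _+_; _-_; _*_; 0ℤ; 1ℤ)
open import Data.List using (List; []; _∷_)

-- A polynomial in one variable with integer coefficients, as its list of
-- coefficients (constant term first), and its evaluation (Horner).
Poly : Set
Poly = List ℤ

eval : Poly → ℤ → ℤ
eval []       x = 0ℤ
eval (c ∷ cs) x = c + x * eval cs x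

-- F n v z  is the value of  F_n^{(v)}(z)  (for n ≥ 1).
-- F 0 is a junk value (never used by the statement).
F : ℕ → ℤ → ℤ → ℤ
F zero          v z = 1ℤ
F (suc zero)    v z = 1ℤ
F (suc (suc n)) v z =
  (z + 1ℤ) * (z - v + 1ℤ) * F (suc n) v (z + 1ℤ) - z * (z - v) * F (suc n) v z

g : ℕ → ℤ → ℤ
g n v = F n v v

{-# OPTIONS --safe #-}
-- At z = v the recurrence loses its second term, which carries the factor z − v, so
-- g_{n+1}(v) = (v + 1) · F_n^{(v)}(v + 1).  The cofactor F_n^{(v)}(v + 1) is a polynomial
-- in v because substituting a polynomial a(v) for z in F_n^{(v)}(z) gives a polynomial:
-- the recurrence only adds and multiplies such substitutions (with a and a + 1).
module Submission where

open import Defs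
open import Data.Nat using (ℕ; _≤_; zero; suc; s≤s; z≤n)
open import Data.Integer using (ℤ; _+_; _*_; _-_; -_; 0ℤ; 1ℤ; -1ℤ)
open import Data.Integer.Properties using (+-identityˡ; +-identityʳ; *-zeroʳ; -1*i≡-i)
open import Data.Integer.Solver using (module +-*-Solver)
open import Data.Product using (∃; _,_)
open import Data.List using ([]; _∷_)
open import Relation.Binary.PropositionalEquality using (_≡_; refl; sym; trans; cong; cong₂)
open +-*-Solver

infixl 6 _+ₚ_
infixl 7 _*ₚ_ _·ₚ_

_+ₚ_ : Poly → Poly → Poly
[]      +ₚ q       = q
(a ∷ p) +ₚ []      = a ∷ p
(a ∷ p) +ₚ (b ∷ q) = (a + b) ∷ (p +ₚ q)

_·ₚ_ : ℤ → Poly → Poly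
c ·ₚ []      = []
c ·ₚ (a ∷ p) = c * a ∷ c ·ₚ p

_*ₚ_ : Poly → Poly → Poly
[]      *ₚ q = []
(a ∷ p) *ₚ q = a ·ₚ q +ₚ (0ℤ ∷ p *ₚ q)

eval-+ₚ : ∀ p q x → eval (p +ₚ q) x ≡ eval p x + eval q x
eval-+ₚ []      q       x = sym (+-identityˡ (eval q x))
eval-+ₚ (a ∷ p) []      x = sym (+-identityʳ (eval (a ∷ p) x))
eval-+ₚ (a ∷ p) (b ∷ q) x rewrite eval-+ₚ p q x =
  solve 5 (λ a b x P Q → (a :+ b) :+ x :* (P :+ Q) := (a :+ x :* P) :+ (b :+ x :* Q))
    refl a b x (eval p x) (eval q x)

eval-·ₚ : ∀ c p x → eval (c ·ₚ p) x ≡ c * eval p x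
eval-·ₚ c []      x = sym (*-zeroʳ c)
eval-·ₚ c (a ∷ p) x rewrite eval-·ₚ c p x =
  solve 4 (λ c a x P → c :* a :+ x :* (c :* P) := c :* (a :+ x :* P)) refl c a x (eval p x)

eval-*ₚ : ∀ p q x → eval (p *ₚ q) x ≡ eval p x * eval q x
eval-*ₚ []      q x = refl
eval-*ₚ (a ∷ p) q x
  rewrite eval-+ₚ (a ·ₚ q) (0ℤ ∷ p *ₚ q) x | eval-·ₚ a q x | eval-*ₚ p q x =
  solve 4 (λ a x P Q → a :* Q :+ (con 0ℤ :+ x :* (P :* Q)) := (a :+ x :* P) :* Q)
    refl a x (eval p x) (eval q x)

IsPolynomial : (ℤ → ℤ) → Set
IsPolynomial f = ∃ λ (p : Poly) → ∀ v → f v ≡ eval p v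

const-isPolynomial : ∀ c → IsPolynomial (λ _ → c)
const-isPolynomial c = c ∷ [] , λ v → solve 2 (λ c v → c := c :+ v :* con 0ℤ) refl c v

id-isPolynomial : IsPolynomial (λ v → v)
id-isPolynomial = 0ℤ ∷ 1ℤ ∷ [] ,
  λ v → solve 1 (λ v → v := con 0ℤ :+ v :* (con 1ℤ :+ v :* con 0ℤ)) refl v

+-isPolynomial : ∀ {f h} → IsPolynomial f → IsPolynomial h → IsPolynomial (λ v → f v + h v)
+-isPolynomial (p , f≡p) (q , h≡q) =
  p +ₚ q , λ v → trans (cong₂ _+_ (f≡p v) (h≡q v)) (sym (eval-+ₚ p q v))

*-isPolynomial : ∀ {f h} → IsPolynomial f → IsPolynomial h → IsPolynomial (λ v → f v * h v)
*-isPolynomial (p , f≡p) (q , h≡q) =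
  p *ₚ q , λ v → trans (cong₂ _*_ (f≡p v) (h≡q v)) (sym (eval-*ₚ p q v))

neg-isPolynomial : ∀ {f} → IsPolynomial f → IsPolynomial (λ v → - f v)
neg-isPolynomial (p , f≡p) =
  -1ℤ ·ₚ p , λ v → trans (cong -_ (f≡p v)) (sym (trans (eval-·ₚ -1ℤ p v) (-1*i≡-i (eval p v))))

minus-isPolynomial : ∀ {f h} → IsPolynomial f → IsPolynomial h → IsPolynomial (λ v → f v - h v)
minus-isPolynomial pf ph = +-isPolynomial pf (neg-isPolynomial ph)

F-isPolynomial : ∀ n {a} → IsPolynomial a → IsPolynomial (λ v → F n v (a v))
F-isPolynomial zero          _      = const-isPolynomial 1ℤ
F-isPolynomial (suc zero)    _      = const-isPolynomial 1ℤ
F-isPolynomial (suc (suc n)) {a} a-poly =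
  minus-isPolynomial
    (*-isPolynomial (*-isPolynomial a+1-poly (+-isPolynomial a-v-poly one))
                    (F-isPolynomial (suc n) a+1-poly))
    (*-isPolynomial (*-isPolynomial a-poly a-v-poly) (F-isPolynomial (suc n) a-poly))
  where
  one : IsPolynomial (λ _ → 1ℤ)
  one = const-isPolynomial 1ℤ

  a+1-poly : IsPolynomial (λ v → a v + 1ℤ)
  a+1-poly = +-isPolynomial a-poly one

  a-v-poly : IsPolynomial (λ v → a v - v)
  a-v-poly = minus-isPolynomial a-poly id-isPolynomial

g-suc : ∀ n v → g (suc (suc n)) v ≡ (v + 1ℤ) * F (suc n) v (v + 1ℤ)
g-suc n v =
  solve 3 (λ v A B → (v :+ con 1ℤ) :* (v :- v :+ con 1ℤ) :* A :- v :* (v :- v) :* B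
                     := (v :+ con 1ℤ) :* A)
    refl v (F (suc n) v (v + 1ℤ)) (F (suc n) v v)

proposition10 : ∀ (n : ℕ) → 2 ≤ n →
    ∃ λ (q : Poly) → ∀ (v : ℤ) → g n v ≡ (v + 1ℤ) * eval q v
proposition10 (suc (suc n)) (s≤s (s≤s z≤n)) =
  let (q , F≡q) = F-isPolynomial (suc n) (+-isPolynomial id-isPolynomial (const-isPolynomial 1ℤ))
  in  q , λ v → trans (g-suc n v) (cong ((v + 1ℤ) *_) (F≡q v))
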